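{- Let $\Gamma_1,\Gamma_2$ be graphs with $|\Gamma_1|=m$, $|\Gamma_2|=n$, and order the vertices of the strong product $\Gamma_1\boxtimes\Gamma_2$ lexicographically. (a) $A_{\Gamma_1\boxtimes\Gamma_2}=A_{\Gamma_1}\otimes A_{\Gamma_2}$ (Kronecker product). (b) If $A_{\Gamma_1}$ has elementary divisors $a_1\mid\cdots\mid a_m$ and $A_{\Gamma_2}$ has elementary divisors $b_1\mid\cdots\mid b_n$ (some possibly $0$), then $A_{\Gamma_1\boxtimes\Gamma_2}$ is equivalent over $\mathbb{Z}$ to the diagonal matrix with diagonal entries $a_ib_j$ ($1\le i\le m$, $1\le j\le n$); i.e. its elementary divisors are obtained from the products $\{a_ib_j\}$ up to rearrangement of prime factors. (c) $C_{\Gamma_1\boxtimes\Gamma_2}=C_{\Gamma_1}\otimes C_{\Gamma_2}$ (up to the ordering of rows), so the elementary divisors of $C_{\Gamma_1\boxtimes\Gamma_2}$ are obtained from the products of the elementary divisors of $C_{\Gamma_1}$ and $C_{\Gamma_2}$ up to rearrangement of prime factors.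
   Context: All graphs are finite and simple. The strong product $\Gamma_1\boxtimes\Gamma_2$ has vertices $(u_1,u_2)$ with $u_i\in\Gamma_i$, and $(u_1,u_2)\neq(v_1,v_2)$ are adjacent iff each coordinate pair is equal or adjacent. The activation matrix $A_\Gamma$ is the adjacency matrix of $\Gamma$ plus the identity. $N[v]$ is the closed neighbourhood; for a vertex set $S$, $\vec S$ is its $0/1$ indicator vector. The RA matrix $C_\Gamma$ has one column per vertex and rows $\vec{N[v]}$ for all vertices $v$ together with $\overrightarrow{N[u]\cap N[v]}$ for all pairs $u,v$. Elementary divisors of an integer matrix are the diagonal entries of its Smith normal form. -}

module Defs where

open import Data.Nat as ℕ using (ℕ; zero; suc)
open import Data.Integer as ℤ using (ℤ; +_)
open import Data.Bool using (Bool; true; false; _∧_; _∨_; not; if_then_else_)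
open import Data.Fin as Fin using (Fin; toℕ; quotient; remainder; splitAt; remQuot; _≟_)
open import Data.Sum using (inj₁; inj₂)
open import Data.Product using (_×_; _,_; Σ; ∃)
open import Relation.Nullary using (does)
open import Relation.Binary.PropositionalEquality using (_≡_)

record Graph (m : ℕ) : Set where
  field
    adj     : Fin m → Fin m → Bool
    adj-sym : ∀ u v → adj u v ≡ adj v u
    adj-irr : ∀ u → adj u u ≡ false
open Graph public

_==_ : ∀ {m} → Fin m → Fin m → Bool
u == v = does (u ≟ v)

inN : ∀ {m} → Graph m → Fin m → Fin m → Bool
inN G v w = (v == w) ∨ adj G v w

-- Strong product; vertex (u₁ , u₂) is encoded as Fin.combine u₁ u₂ : Fin (m * n),
-- i.e. the vertices are ordered lexicographically.

strongAdj : ∀ {m n} → Graph m → Graph n → Fin (m ℕ.* n) → Fin (m ℕ.* n) → Bool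
strongAdj {m} {n} G H p q =
  not (p == q) ∧ (inN G (quotient n p) (quotient n q) ∧ inN H (remainder {m} n p) (remainder {m} n q))

private
  ∨-comm : ∀ a b → (a ∨ b) ≡ (b ∨ a)
  ∨-comm false false = _≡_.refl
  ∨-comm false true  = _≡_.refl
  ∨-comm true  false = _≡_.refl
  ∨-comm true  true  = _≡_.refl

  ==-sym : ∀ {m} (u v : Fin m) → (u == v) ≡ (v == u)
  ==-sym u v with u ≟ v | v ≟ u
  ... | Relation.Nullary.yes _ | Relation.Nullary.yes _ = _≡_.refl
  ... | Relation.Nullary.no _  | Relation.Nullary.no _  = _≡_.refl
  ... | Relation.Nullary.yes e | Relation.Nullary.no ne = Data.Empty.⊥-elim (ne (Relation.Binary.PropositionalEquality.sym e))
    where import Data.Empty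
  ... | Relation.Nullary.no ne | Relation.Nullary.yes e = Data.Empty.⊥-elim (ne (Relation.Binary.PropositionalEquality.sym e))
    where import Data.Empty

  ==-refl : ∀ {m} (u : Fin m) → (u == u) ≡ true
  ==-refl u with u ≟ u
  ... | Relation.Nullary.yes _ = _≡_.refl
  ... | Relation.Nullary.no ne = Data.Empty.⊥-elim (ne _≡_.refl)
    where import Data.Empty

  inN-sym : ∀ {m} (G : Graph m) u v → inN G u v ≡ inN G v u
  inN-sym G u v rewrite ==-sym u v | adj-sym G u v = _≡_.refl

strongProduct : ∀ {m n} → Graph m → Graph n → Graph (m ℕ.* n)
strongProduct {m} {n} G H = record
  { adj     = strongAdj G H
  ; adj-sym = λ p q → sy p q
  ; adj-irr = λ p → ir p
  }
  where
  sy : ∀ p q → strongAdj G H p q ≡ strongAdj G H q p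
  sy p q rewrite ==-sym p q
               | inN-sym G (quotient n p) (quotient n q)
               | inN-sym H (remainder {m} n p) (remainder {m} n q) = _≡_.refl
  ir : ∀ p → strongAdj G H p p ≡ false
  ir p rewrite ==-refl p = _≡_.refl

_⊠_ : ∀ {m n} → Graph m → Graph n → Graph (m ℕ.* n)
_⊠_ = strongProduct

Matrix : ℕ → ℕ → Set
Matrix r c = Fin r → Fin c → ℤ

ind : Bool → ℤ
ind b = if b then + 1 else + 0

sumFin : ∀ k → (Fin k → ℤ) → ℤ
sumFin zero    f = + 0
sumFin (suc k) f = f Fin.zero ℤ.+ sumFin k (λ i → f (Fin.suc i))

_·_ : ∀ {r k c} → Matrix r k → Matrix k c → Matrix r c
_·_ {k = k} A B i j = sumFin k (λ l → A i l ℤ.* B l j)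

identity : ∀ n → Matrix n n
identity n i j = ind (i == j)

_⊗_ : ∀ {r₁ c₁ r₂ c₂} → Matrix r₁ c₁ → Matrix r₂ c₂ → Matrix (r₁ ℕ.* r₂) (c₁ ℕ.* c₂)
_⊗_ {r₁} {c₁} {r₂} {c₂} A B p q =
  A (quotient r₂ p) (quotient c₂ q) ℤ.* B (remainder {r₁} r₂ p) (remainder {c₁} c₂ q)

Unimodular : ∀ {n} → Matrix n n → Set
Unimodular {n} P = Σ (Matrix n n) λ P' →
  (∀ i j → (P · P') i j ≡ identity n i j) × (∀ i j → (P' · P) i j ≡ identity n i j)

EquivZ : ∀ {r c} → Matrix r c → Matrix r c → Set
EquivZ {r} {c} A B = Σ (Matrix r r) λ P → Σ (Matrix c c) λ Q →
  Unimodular P × Unimodular Q × (∀ i j → ((P · A) · Q) i j ≡ B i j)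

diagR : ∀ r {c} → (Fin c → ℕ) → Matrix r c
diagR r d i j = if does (toℕ i ℕ.≟ toℕ j) then + d j else + 0

-- d₁ ∣ d₂ ∣ … ∣ d_c are the elementary divisors of the r × c matrix A (with c ≤ r):
-- A is equivalent over ℤ to its Smith normal form diag(d₁,…,d_c).
ElementaryDivisors : ∀ {r c} → Matrix r c → (Fin c → ℕ) → Set
ElementaryDivisors {r} {c} A d =
  (∀ (i j : Fin c) → toℕ i ℕ.≤ toℕ j → d i Data.Nat.Divisibility.∣ d j) × EquivZ A (diagR r d)
  where import Data.Nat.Divisibility

activation : ∀ {m} → Graph m → Matrix m m
activation G v w = ind (inN G v w)

-- RA matrix C_Γ: rows indexed by Fin (m + m * m):
--   row (v ↑ˡ _)          is  N[v]
--   row (m ↑ʳ combine u v) is  N[u] ∩ N[v]   (all ordered pairs (u , v))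
RA : ∀ {m} → Graph m → Matrix (m ℕ.+ m ℕ.* m) m
RA {m} G row w with splitAt m row
... | inj₁ v = ind (inN G v w)
... | inj₂ p with remQuot {m} m p
...   | u , v = ind (inN G u w ∧ inN G v w)

SameRowSet : ∀ {r r' c} → Matrix r c → Matrix r' c → Set
SameRowSet {r} {r'} A B =
  (∀ i → ∃ λ i' → ∀ j → A i j ≡ B i' j) × (∀ i' → ∃ λ i → ∀ j → A i j ≡ B i' j)

-- Part (a): (u', v') ∈ N[(u, v)] in Γ₁ ⊠ Γ₂ iff u' ∈ N[u] and v' ∈ N[v], so the indicator of a closed
-- neighbourhood in the product is the product of the two indicators. Part (b): by the mixed-product rule
-- (A ⊗ B)(C ⊗ D) = AC ⊗ BD the Kronecker product of two equivalences over ℤ is again one, and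
-- diag(a) ⊗ diag(b) = diag(aᵢ bⱼ). Part (c): the rows of C_{Γ₁⊠Γ₂} are exactly the rows of C_{Γ₁} ⊗ C_{Γ₂},
-- but the two matrices have different numbers of rows, so (b) does not apply directly. Instead we only keep
-- track of the row lattice: an equivalence C ~ diag(c) yields a unimodular Q such that the rows of C Q and of
-- diag(c) span the same lattice. This property is preserved by ⊗ and depends only on the set of rows; and it
-- turns back into an equivalence with diag(c) because every row N[v] of an RA matrix reappears as the row
-- N[v] ∩ N[v], which lets two block row shears bring C Q to diag(c) stacked on zeros.

module Submission where

open import Defs
open import Algebra.Bundles using (CommutativeMonoid)
open import Data.Bool using (Bool; true; false; _∧_; if_then_else_)
import Data.Bool.Properties as BoolP
open import Data.Empty using (⊥-elim)
open import Data.Fin using (Fin; zero; suc; toℕ; _↑ˡ_; _↑ʳ_; splitAt; combine; quotient; remainder; punchIn; _≟_)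
import Data.Fin.Properties as FinP
open import Data.Integer as ℤ using (ℤ; +_; _+_; _*_; -_)
import Data.Integer.Properties as ℤP
open import Data.Integer.Tactic.RingSolver using (solve-∀)
open import Data.Nat as ℕ using (ℕ; zero; suc)
import Data.Nat.Properties as ℕP
open import Data.Product using (_×_; _,_; Σ; proj₁; proj₂)
open import Data.Sum using (inj₁; inj₂; [_,_])
open import Function using (_∘_)
open import Relation.Nullary using (yes; no)
open import Relation.Nullary.Decidable using (dec-true; dec-false)
open import Relation.Binary.Bundles using (Setoid)
import Relation.Binary.Reasoning.Setoid
open import Relation.Binary.PropositionalEquality hiding ([_])

open import Algebra.Properties.Semiring.Sum ℤP.+-*-semiring
  using (sum; sum-cong-≗; ∑-distrib-+; ∑-comm; *-distribˡ-sum; *-distribʳ-sum; sum-replicate-zero; sum-remove)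
open import Algebra.Properties.CommutativeSemigroup (CommutativeMonoid.commutativeSemigroup BoolP.∧-commutativeMonoid)
  using () renaming (interchange to ∧-interchange)

sumFin≡sum : ∀ k (f : Fin k → ℤ) → sumFin k f ≡ sum f
sumFin≡sum zero    f = refl
sumFin≡sum (suc k) f = cong (_+_ (f zero)) (sumFin≡sum k (λ i → f (suc i)))

sumFin-cong : ∀ k {f g : Fin k → ℤ} → (∀ i → f i ≡ g i) → sumFin k f ≡ sumFin k g
sumFin-cong k {f} {g} f≗g =
  trans (sumFin≡sum k f) (trans (sum-cong-≗ f≗g) (sym (sumFin≡sum k g)))

sumFin-distrib-+ : ∀ k (f g : Fin k → ℤ) →
  sumFin k (λ i → f i + g i) ≡ sumFin k f + sumFin k g
sumFin-distrib-+ k f g = begin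
  sumFin k (λ i → f i + g i)  ≡⟨ sumFin≡sum k _ ⟩
  sum (λ i → f i + g i)       ≡⟨ ∑-distrib-+ f g ⟩
  sum f + sum g               ≡⟨ cong₂ _+_ (sumFin≡sum k f) (sumFin≡sum k g) ⟨
  sumFin k f + sumFin k g     ∎
  where open ≡-Reasoning

sumFin-comm : ∀ a b (f : Fin a → Fin b → ℤ) →
  sumFin a (λ i → sumFin b (f i)) ≡ sumFin b (λ j → sumFin a (λ i → f i j))
sumFin-comm a b f = begin
  sumFin a (λ i → sumFin b (f i))           ≡⟨ sumFin≡sum a _ ⟩
  sum (λ i → sumFin b (f i))                ≡⟨ sum-cong-≗ (λ i → sumFin≡sum b (f i)) ⟩
  sum (λ i → sum (f i))                     ≡⟨ ∑-comm f ⟩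
  sum (λ j → sum (λ i → f i j))             ≡⟨ sum-cong-≗ (λ j → sumFin≡sum a (λ i → f i j)) ⟨
  sum (λ j → sumFin a (λ i → f i j))        ≡⟨ sumFin≡sum b _ ⟨
  sumFin b (λ j → sumFin a (λ i → f i j))   ∎
  where open ≡-Reasoning

*-distribˡ-sumFin : ∀ k x (f : Fin k → ℤ) → x * sumFin k f ≡ sumFin k (λ i → x * f i)
*-distribˡ-sumFin k x f = begin
  x * sumFin k f              ≡⟨ cong (x *_) (sumFin≡sum k f) ⟩
  x * sum f                   ≡⟨ *-distribˡ-sum x f ⟩
  sum (λ i → x * f i)         ≡⟨ sumFin≡sum k _ ⟨
  sumFin k (λ i → x * f i)    ∎
  where open ≡-Reasoning

*-distribʳ-sumFin : ∀ k x (f : Fin k → ℤ) → sumFin k f * x ≡ sumFin k (λ i → f i * x)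
*-distribʳ-sumFin k x f = begin
  sumFin k f * x              ≡⟨ cong (_* x) (sumFin≡sum k f) ⟩
  sum f * x                   ≡⟨ *-distribʳ-sum x f ⟩
  sum (λ i → f i * x)         ≡⟨ sumFin≡sum k _ ⟨
  sumFin k (λ i → f i * x)    ∎
  where open ≡-Reasoning

sumFin-zero : ∀ k {f : Fin k → ℤ} → (∀ i → f i ≡ + 0) → sumFin k f ≡ + 0
sumFin-zero k {f} f≗0 = trans (sumFin≡sum k f) (trans (sum-cong-≗ f≗0) (sum-replicate-zero k))

sumFin-select : ∀ k (i : Fin k) (f : Fin k → ℤ) → (∀ l → l ≢ i → f l ≡ + 0) → sumFin k f ≡ f i
sumFin-select (suc k) i f vanishes = begin
  sumFin (suc k) f                  ≡⟨ sumFin≡sum (suc k) f ⟩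
  sum f                             ≡⟨ sum-remove {i = i} f ⟩
  f i + sum (λ l → f (punchIn i l)) ≡⟨ cong (_+_ (f i)) (trans (sum-cong-≗ off-i) (sum-replicate-zero k)) ⟩
  f i + + 0                         ≡⟨ ℤP.+-identityʳ (f i) ⟩
  f i                               ∎
  where
  open ≡-Reasoning
  off-i : ∀ l → f (punchIn i l) ≡ + 0
  off-i l = vanishes (punchIn i l) (FinP.punchInᵢ≢i i l)

sumFin-neg : ∀ k (f : Fin k → ℤ) → sumFin k (λ i → - f i) ≡ - sumFin k f
sumFin-neg k f = begin
  sumFin k (λ i → - f i)         ≡⟨ sumFin-cong k (λ i → sym (ℤP.-1*i≡-i (f i))) ⟩
  sumFin k (λ i → ℤ.-1ℤ * f i)   ≡⟨ *-distribˡ-sumFin k ℤ.-1ℤ f ⟨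
  ℤ.-1ℤ * sumFin k f             ≡⟨ ℤP.-1*i≡-i _ ⟩
  - sumFin k f                   ∎
  where open ≡-Reasoning

sumFin-↑ : ∀ a b (f : Fin (a ℕ.+ b) → ℤ) →
  sumFin (a ℕ.+ b) f ≡ sumFin a (λ i → f (i ↑ˡ b)) + sumFin b (λ k → f (a ↑ʳ k))
sumFin-↑ zero    b f = sym (ℤP.+-identityˡ _)
sumFin-↑ (suc a) b f = trans (cong (_+_ (f zero)) (sumFin-↑ a b (λ i → f (suc i))))
                             (sym (ℤP.+-assoc (f zero) _ _))

sumFin-combine : ∀ a b (f : Fin (a ℕ.* b) → ℤ) →
  sumFin (a ℕ.* b) f ≡ sumFin a (λ i → sumFin b (λ j → f (combine i j)))
sumFin-combine zero    b f = refl
sumFin-combine (suc a) b f =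
  trans (sumFin-↑ b (a ℕ.* b) f) (cong (_+_ (sumFin b (λ j → f (j ↑ˡ a ℕ.* b)))) (sumFin-combine a b (λ i → f (b ↑ʳ i))))

infix 4 _≋_
_≋_ : ∀ {r c} → Matrix r c → Matrix r c → Set
A ≋ B = ∀ i j → A i j ≡ B i j

≋-refl : ∀ {r c} {A : Matrix r c} → A ≋ A
≋-refl i j = refl

≋-sym : ∀ {r c} {A B : Matrix r c} → A ≋ B → B ≋ A
≋-sym A≋B i j = sym (A≋B i j)

≋-trans : ∀ {r c} {A B C : Matrix r c} → A ≋ B → B ≋ C → A ≋ C
≋-trans A≋B B≋C i j = trans (A≋B i j) (B≋C i j)

≋-setoid : ℕ → ℕ → Setoid _ _
≋-setoid r c = record
  { Carrier       = Matrix r c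
  ; _≈_           = _≋_
  ; isEquivalence = record { refl = ≋-refl ; sym = ≋-sym ; trans = ≋-trans }
  }

module ≋-Reasoning {r c : ℕ} = Relation.Binary.Reasoning.Setoid (≋-setoid r c)

0ᴹ : ∀ {r c} → Matrix r c
0ᴹ i j = + 0

infixl 6 _+ᴹ_
_+ᴹ_ : ∀ {r c} → Matrix r c → Matrix r c → Matrix r c
(A +ᴹ B) i j = A i j + B i j

-ᴹ_ : ∀ {r c} → Matrix r c → Matrix r c
(-ᴹ A) i j = - A i j

+ᴹ-cong : ∀ {r c} {A A' B B' : Matrix r c} → A ≋ A' → B ≋ B' → A +ᴹ B ≋ A' +ᴹ B'
+ᴹ-cong A≋A' B≋B' i j = cong₂ _+_ (A≋A' i j) (B≋B' i j)

+ᴹ-congˡ : ∀ {r c} (A : Matrix r c) {B B' : Matrix r c} → B ≋ B' → A +ᴹ B ≋ A +ᴹ B'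
+ᴹ-congˡ A = +ᴹ-cong (≋-refl {A = A})

+-identityᴹˡ : ∀ {r k} (A : Matrix r k) → 0ᴹ +ᴹ A ≋ A
+-identityᴹˡ A i j = ℤP.+-identityˡ (A i j)

+-identityᴹʳ : ∀ {r k} (A : Matrix r k) → A +ᴹ 0ᴹ ≋ A
+-identityᴹʳ A i j = ℤP.+-identityʳ (A i j)

+-assocᴹ : ∀ {r k} (A B C : Matrix r k) → (A +ᴹ B) +ᴹ C ≋ A +ᴹ (B +ᴹ C)
+-assocᴹ A B C i j = ℤP.+-assoc (A i j) (B i j) (C i j)

+-commᴹ : ∀ {r k} (A B : Matrix r k) → A +ᴹ B ≋ B +ᴹ A
+-commᴹ A B i j = ℤP.+-comm (A i j) (B i j)

·-cong : ∀ {r k c} {A A' : Matrix r k} {B B' : Matrix k c} → A ≋ A' → B ≋ B' → A · B ≋ A' · B'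
·-cong {k = k} A≋A' B≋B' i j = sumFin-cong k (λ l → cong₂ _*_ (A≋A' i l) (B≋B' l j))

·-congʳ : ∀ {r k c} {A A' : Matrix r k} (B : Matrix k c) → A ≋ A' → A · B ≋ A' · B
·-congʳ B A≋A' = ·-cong A≋A' (≋-refl {A = B})

·-congˡ : ∀ {r k c} (A : Matrix r k) {B B' : Matrix k c} → B ≋ B' → A · B ≋ A · B'
·-congˡ A = ·-cong (≋-refl {A = A})

·-assoc : ∀ {r k l c} (A : Matrix r k) (B : Matrix k l) (C : Matrix l c) → (A · B) · C ≋ A · (B · C)
·-assoc {k = k} {l = l} A B C i j = begin
  sumFin l (λ x → sumFin k (λ y → A i y * B y x) * C x j)    ≡⟨ sumFin-cong l (λ x → *-distribʳ-sumFin k (C x j) _) ⟩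
  sumFin l (λ x → sumFin k (λ y → A i y * B y x * C x j))    ≡⟨ sumFin-comm l k _ ⟩
  sumFin k (λ y → sumFin l (λ x → A i y * B y x * C x j))    ≡⟨ sumFin-cong k (λ y → sumFin-cong l (λ x → ℤP.*-assoc (A i y) (B y x) (C x j))) ⟩
  sumFin k (λ y → sumFin l (λ x → A i y * (B y x * C x j)))  ≡⟨ sumFin-cong k (λ y → *-distribˡ-sumFin l (A i y) _) ⟨
  sumFin k (λ y → A i y * sumFin l (λ x → B y x * C x j))    ∎
  where open ≡-Reasoning

==-refl : ∀ {k} (i : Fin k) → (i == i) ≡ true
==-refl i = dec-true (i ≟ i) refl

==-≢ : ∀ {k} {i j : Fin k} → i ≢ j → (i == j) ≡ false
==-≢ {i = i} {j} i≢j = dec-false (i ≟ j) i≢j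

·-identityˡ : ∀ {r c} (A : Matrix r c) → identity r · A ≋ A
·-identityˡ {r} A i j = begin
  (identity r · A) i j      ≡⟨ sumFin-select r i _ off-diagonal ⟩
  ind (i == i) * A i j      ≡⟨ cong (λ b → ind b * A i j) (==-refl i) ⟩
  + 1 * A i j               ≡⟨ ℤP.*-identityˡ (A i j) ⟩
  A i j                     ∎
  where
  open ≡-Reasoning
  off-diagonal : ∀ l → l ≢ i → ind (i == l) * A l j ≡ + 0
  off-diagonal l l≢i rewrite ==-≢ (λ i≡l → l≢i (sym i≡l)) = refl

·-identityʳ : ∀ {r c} (A : Matrix r c) → A · identity c ≋ A
·-identityʳ {c = c} A i j = begin
  (A · identity c) i j      ≡⟨ sumFin-select c j _ off-diagonal ⟩
  A i j * ind (j == j)      ≡⟨ cong (λ b → A i j * ind b) (==-refl j) ⟩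
  A i j * + 1               ≡⟨ ℤP.*-identityʳ (A i j) ⟩
  A i j                     ∎
  where
  open ≡-Reasoning
  off-diagonal : ∀ l → l ≢ j → A i l * ind (l == j) ≡ + 0
  off-diagonal l l≢j rewrite ==-≢ l≢j = ℤP.*-zeroʳ (A i l)

·-distribʳ-+ᴹ : ∀ {r k c} (A B : Matrix r k) (C : Matrix k c) → (A +ᴹ B) · C ≋ A · C +ᴹ B · C
·-distribʳ-+ᴹ {k = k} A B C i j =
  trans (sumFin-cong k (λ l → ℤP.*-distribʳ-+ (C l j) (A i l) (B i l))) (sumFin-distrib-+ k _ _)

·-negˡ : ∀ {r k c} (A : Matrix r k) (B : Matrix k c) → (-ᴹ A) · B ≋ -ᴹ (A · B)
·-negˡ {k = k} A B i j =
  trans (sumFin-cong k (λ l → sym (ℤP.neg-distribˡ-* (A i l) (B l j)))) (sumFin-neg k _)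

·-zeroˡ : ∀ {r k c} (A : Matrix k c) → 0ᴹ {r} · A ≋ 0ᴹ
·-zeroˡ {k = k} A i j = sumFin-zero k (λ l → ℤP.*-zeroˡ (A l j))

·-zeroʳ : ∀ {r k c} (A : Matrix r k) → A · 0ᴹ {k} {c} ≋ 0ᴹ
·-zeroʳ {k = k} A i j = sumFin-zero k (λ l → ℤP.*-zeroʳ (A i l))

Unimodular-· : ∀ {n} {P Q : Matrix n n} → Unimodular P → Unimodular Q → Unimodular (P · Q)
Unimodular-· {n} {P} {Q} (P⁻¹ , PP⁻¹≋I , P⁻¹P≋I) (Q⁻¹ , QQ⁻¹≋I , Q⁻¹Q≋I) =
  Q⁻¹ · P⁻¹ , cancel P Q Q⁻¹ P⁻¹ QQ⁻¹≋I PP⁻¹≋I , cancel Q⁻¹ P⁻¹ P Q P⁻¹P≋I Q⁻¹Q≋I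
  where
  cancel : ∀ A B B' A' → B · B' ≋ identity n → A · A' ≋ identity n → (A · B) · (B' · A') ≋ identity n
  cancel A B B' A' BB'≋I AA'≋I = begin
    (A · B) · (B' · A')   ≈⟨ ·-assoc A B (B' · A') ⟩
    A · (B · (B' · A'))   ≈⟨ ·-congˡ A (·-assoc B B' A') ⟨
    A · ((B · B') · A')   ≈⟨ ·-congˡ A (·-congʳ A' BB'≋I) ⟩
    A · (identity n · A') ≈⟨ ·-congˡ A (·-identityˡ A') ⟩
    A · A'                ≈⟨ AA'≋I ⟩
    identity n            ∎
    where open ≋-Reasoning

≋⇒EquivZ : ∀ {r c} {A B : Matrix r c} → A ≋ B → EquivZ A B
≋⇒EquivZ {r} {c} {A} A≋B =
  identity r , identity c , identity-unimodular r , identity-unimodular c ,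
  ≋-trans (·-identityʳ (identity r · A)) (≋-trans (·-identityˡ A) A≋B)
  where
  identity-unimodular : ∀ n → Unimodular (identity n)
  identity-unimodular n = identity n , ·-identityˡ (identity n) , ·-identityˡ (identity n)

EquivZ-trans : ∀ {r c} {A B C : Matrix r c} → EquivZ A B → EquivZ B C → EquivZ A C
EquivZ-trans {A = A} {B} {C} (P , Q , P-unimodular , Q-unimodular , PAQ≋B) (P' , Q' , P'-unimodular , Q'-unimodular , P'BQ'≋C) =
  P' · P , Q · Q' , Unimodular-· P'-unimodular P-unimodular , Unimodular-· Q-unimodular Q'-unimodular , (begin
    ((P' · P) · A) · (Q · Q')   ≈⟨ ·-congʳ (Q · Q') (·-assoc P' P A) ⟩
    (P' · (P · A)) · (Q · Q')   ≈⟨ ·-assoc (P' · (P · A)) Q Q' ⟨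
    ((P' · (P · A)) · Q) · Q'   ≈⟨ ·-congʳ Q' (·-assoc P' (P · A) Q) ⟩
    (P' · ((P · A) · Q)) · Q'   ≈⟨ ·-congʳ Q' (·-congˡ P' PAQ≋B) ⟩
    (P' · B) · Q'               ≈⟨ P'BQ'≋C ⟩
    C                           ∎)
  where open ≋-Reasoning

quotient-combine : ∀ {a b} (i : Fin a) (j : Fin b) → quotient b (combine i j) ≡ i
quotient-combine i j = cong proj₁ (FinP.remQuot-combine i j)

remainder-combine : ∀ {a b} (i : Fin a) (j : Fin b) → remainder {a} b (combine i j) ≡ j
remainder-combine i j = cong proj₂ (FinP.remQuot-combine i j)

remQuot-injective : ∀ {a b} {p q : Fin (a ℕ.* b)} →
  quotient {a} b p ≡ quotient {a} b q → remainder {a} b p ≡ remainder {a} b q → p ≡ q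
remQuot-injective {a} {b} {p} {q} quotient≡ remainder≡ = begin
  p                                               ≡⟨ FinP.combine-remQuot {a} b p ⟨
  combine (quotient {a} b p) (remainder {a} b p)  ≡⟨ cong₂ combine quotient≡ remainder≡ ⟩
  combine (quotient {a} b q) (remainder {a} b q)  ≡⟨ FinP.combine-remQuot {a} b q ⟩
  q                                               ∎
  where open ≡-Reasoning

data CombineView (a b : ℕ) : Fin (a ℕ.* b) → Set where
  combined : (i : Fin a) (j : Fin b) → CombineView a b (combine i j)

combineView : ∀ a b (p : Fin (a ℕ.* b)) → CombineView a b p
combineView a b p = subst (CombineView a b) (FinP.combine-remQuot {a} b p) (combined _ _)

==-remQuot : ∀ {a b} (p q : Fin (a ℕ.* b)) →
  (p == q) ≡ (quotient {a} b p == quotient {a} b q) ∧ (remainder {a} b p == remainder {a} b q)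
==-remQuot {a} {b} p q with p ≟ q
... | yes refl rewrite ==-refl (quotient {a} b p) | ==-refl (remainder {a} b p) = refl
... | no p≢q with quotient {a} b p ≟ quotient {a} b q | remainder {a} b p ≟ remainder {a} b q
...   | yes quotient≡ | yes remainder≡ = ⊥-elim (p≢q (remQuot-injective quotient≡ remainder≡))
...   | yes _         | no _           = refl
...   | no _          | _              = refl

ind-∧ : ∀ x y → ind (x ∧ y) ≡ ind x * ind y
ind-∧ false y     = refl
ind-∧ true  false = refl
ind-∧ true  true  = refl

_⊗ᵥ_ : ∀ {m n} → (Fin m → ℕ) → (Fin n → ℕ) → Fin (m ℕ.* n) → ℕ
_⊗ᵥ_ {m} {n} a b p = a (quotient {m} n p) ℕ.* b (remainder {m} n p)

diagR-square : ∀ k (d : Fin k → ℕ) i j → diagR k d i j ≡ ind (i == j) * + d j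
diagR-square k d i j with i ≟ j
... | yes refl rewrite dec-true (toℕ i ℕ.≟ toℕ i) refl = sym (ℤP.*-identityˡ (+ d i))
... | no i≢j   rewrite dec-false (toℕ i ℕ.≟ toℕ j) (i≢j ∘ FinP.toℕ-injective) = refl

diagR-⊗ : ∀ m n (a : Fin m → ℕ) (b : Fin n → ℕ) → diagR m a ⊗ diagR n b ≋ diagR (m ℕ.* n) (a ⊗ᵥ b)
diagR-⊗ m n a b p q = begin
  (diagR m a ⊗ diagR n b) p q                   ≡⟨ cong₂ _*_ (diagR-square m a (quotient {m} n p) q₁) (diagR-square n b (remainder {m} n p) q₂) ⟩
  (ind same-q * + a q₁) * (ind same-r * + b q₂)  ≡⟨ interchange (ind same-q) (+ a q₁) (ind same-r) (+ b q₂) ⟩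
  (ind same-q * ind same-r) * (+ a q₁ * + b q₂)  ≡⟨ cong₂ _*_ (ind-∧ same-q same-r) (ℤP.pos-* (a q₁) (b q₂)) ⟨
  ind (same-q ∧ same-r) * + (a ⊗ᵥ b) q           ≡⟨ cong (λ x → ind x * + (a ⊗ᵥ b) q) (==-remQuot {m} {n} p q) ⟨
  ind (p == q) * + (a ⊗ᵥ b) q                    ≡⟨ diagR-square (m ℕ.* n) (a ⊗ᵥ b) p q ⟨
  diagR (m ℕ.* n) (a ⊗ᵥ b) p q                   ∎
  where
  open ≡-Reasoning
  q₁ = quotient {m} n q
  q₂ = remainder {m} n q
  same-q = quotient {m} n p == q₁
  same-r = remainder {m} n p == q₂
  interchange : ∀ w x y z → (w * x) * (y * z) ≡ (w * y) * (x * z)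
  interchange = solve-∀

⊗-cong : ∀ {r₁ c₁ r₂ c₂} {A A' : Matrix r₁ c₁} {B B' : Matrix r₂ c₂} → A ≋ A' → B ≋ B' → A ⊗ B ≋ A' ⊗ B'
⊗-cong A≋A' B≋B' p q = cong₂ _*_ (A≋A' _ _) (B≋B' _ _)

identity-⊗ : ∀ a b → identity a ⊗ identity b ≋ identity (a ℕ.* b)
identity-⊗ a b p q = begin
  ind (quotient {a} b p == quotient {a} b q) * ind (remainder {a} b p == remainder {a} b q)
    ≡⟨ ind-∧ (quotient {a} b p == quotient {a} b q) (remainder {a} b p == remainder {a} b q) ⟨
  ind ((quotient {a} b p == quotient {a} b q) ∧ (remainder {a} b p == remainder {a} b q))
    ≡⟨ cong ind (==-remQuot {a} {b} p q) ⟨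
  ind (p == q)
    ∎
  where open ≡-Reasoning

⊗-mixed-product : ∀ {r₁ k₁ c₁ r₂ k₂ c₂} (A : Matrix r₁ k₁) (B : Matrix r₂ k₂) (C : Matrix k₁ c₁) (D : Matrix k₂ c₂) →
  (A ⊗ B) · (C ⊗ D) ≋ (A · C) ⊗ (B · D)
⊗-mixed-product {r₁} {k₁} {c₁} {r₂} {k₂} {c₂} A B C D p q = begin
  sumFin (k₁ ℕ.* k₂) (λ l → (A ⊗ B) p l * (C ⊗ D) l q)                    ≡⟨ sumFin-combine k₁ k₂ _ ⟩
  sumFin k₁ (λ i → sumFin k₂ (λ j → (A ⊗ B) p (combine i j) * (C ⊗ D) (combine i j) q))
                                                                           ≡⟨ sumFin-cong k₁ (λ i → sumFin-cong k₂ (summand i)) ⟩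
  sumFin k₁ (λ i → sumFin k₂ (λ j → (A x i * C i y) * (B x' j * D j y'))) ≡⟨ sumFin-cong k₁ (λ i → *-distribˡ-sumFin k₂ (A x i * C i y) (λ j → B x' j * D j y')) ⟨
  sumFin k₁ (λ i → (A x i * C i y) * (B · D) x' y')                        ≡⟨ *-distribʳ-sumFin k₁ ((B · D) x' y') (λ i → A x i * C i y) ⟨
  (A · C) x y * (B · D) x' y'                                              ∎
  where
  open ≡-Reasoning
  x = quotient {r₁} r₂ p
  x' = remainder {r₁} r₂ p
  y = quotient {c₁} c₂ q
  y' = remainder {c₁} c₂ q
  interchange : ∀ w x y z → (w * x) * (y * z) ≡ (w * y) * (x * z)
  interchange = solve-∀
  summand : ∀ i j → (A ⊗ B) p (combine i j) * (C ⊗ D) (combine i j) q ≡ (A x i * C i y) * (B x' j * D j y')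
  summand i j rewrite quotient-combine {k₁} {k₂} i j | remainder-combine {k₁} {k₂} i j =
    interchange (A x i) (B x' j) (C i y) (D j y')

⊗-combine : ∀ {r₁ c₁ r₂ c₂} (A : Matrix r₁ c₁) (B : Matrix r₂ c₂) x y w w' →
  (A ⊗ B) (combine x y) (combine w w') ≡ A x w * B y w'
⊗-combine {r₁} {c₁} {r₂} {c₂} A B x y w w'
  rewrite quotient-combine {r₁} {r₂} x y | remainder-combine {r₁} {r₂} x y
        | quotient-combine {c₁} {c₂} w w' | remainder-combine {c₁} {c₂} w w' = refl

Unimodular-⊗ : ∀ {a b} {P : Matrix a a} {Q : Matrix b b} → Unimodular P → Unimodular Q → Unimodular (P ⊗ Q)
Unimodular-⊗ {a} {b} {P} {Q} (P⁻¹ , PP⁻¹≋I , P⁻¹P≋I) (Q⁻¹ , QQ⁻¹≋I , Q⁻¹Q≋I) =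
  P⁻¹ ⊗ Q⁻¹ ,
  ≋-trans (⊗-mixed-product P Q P⁻¹ Q⁻¹) (≋-trans (⊗-cong PP⁻¹≋I QQ⁻¹≋I) (identity-⊗ a b)) ,
  ≋-trans (⊗-mixed-product P⁻¹ Q⁻¹ P Q) (≋-trans (⊗-cong P⁻¹P≋I Q⁻¹Q≋I) (identity-⊗ a b))

EquivZ-⊗ : ∀ {r₁ c₁ r₂ c₂} {A B : Matrix r₁ c₁} {C D : Matrix r₂ c₂} → EquivZ A B → EquivZ C D → EquivZ (A ⊗ C) (B ⊗ D)
EquivZ-⊗ {A = A} {B} {C} {D} (P , Q , P-unimodular , Q-unimodular , PAQ≋B) (P' , Q' , P'-unimodular , Q'-unimodular , P'CQ'≋D) =
  P ⊗ P' , Q ⊗ Q' , Unimodular-⊗ P-unimodular P'-unimodular , Unimodular-⊗ Q-unimodular Q'-unimodular , (begin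
    ((P ⊗ P') · (A ⊗ C)) · (Q ⊗ Q')   ≈⟨ ·-congʳ (Q ⊗ Q') (⊗-mixed-product P P' A C) ⟩
    ((P · A) ⊗ (P' · C)) · (Q ⊗ Q')   ≈⟨ ⊗-mixed-product (P · A) (P' · C) Q Q' ⟩
    ((P · A) · Q) ⊗ ((P' · C) · Q')   ≈⟨ ⊗-cong PAQ≋B P'CQ'≋D ⟩
    B ⊗ D                             ∎)
  where open ≋-Reasoning

-- Block matrices and row shears

module Blocks (c s : ℕ) where

  top : ∀ {k} → Matrix (c ℕ.+ s) k → Matrix c k
  top M i j = M (i ↑ˡ s) j

  bottom : ∀ {k} → Matrix (c ℕ.+ s) k → Matrix s k
  bottom M t j = M (c ↑ʳ t) j

  leftCols : ∀ {r} → Matrix r (c ℕ.+ s) → Matrix r c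
  leftCols E i l = E i (l ↑ˡ s)

  rightCols : ∀ {r} → Matrix r (c ℕ.+ s) → Matrix r s
  rightCols E i t = E i (c ↑ʳ t)

  ·-split : ∀ {r k} (E : Matrix r (c ℕ.+ s)) (M : Matrix (c ℕ.+ s) k) →
    E · M ≋ leftCols E · top M +ᴹ rightCols E · bottom M
  ·-split E M i j = sumFin-↑ c s (λ l → E i l * M l j)

  ≋-blocks : ∀ {k} {M M' : Matrix (c ℕ.+ s) k} → top M ≋ top M' → bottom M ≋ bottom M' → M ≋ M'
  ≋-blocks {M = M} {M'} top≋ bottom≋ r j with splitAt c r in eq
  ... | inj₁ i = subst (λ r → M r j ≡ M' r j) (FinP.splitAt⁻¹-↑ˡ eq) (top≋ i j)
  ... | inj₂ t = subst (λ r → M r j ≡ M' r j) (FinP.splitAt⁻¹-↑ʳ eq) (bottom≋ t j)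

  block : Matrix c c → Matrix c s → Matrix s c → Matrix s s → Matrix (c ℕ.+ s) (c ℕ.+ s)
  block A B C D r l =
    [ (λ i → [ A i , B i ] (splitAt c l)) , (λ t → [ C t , D t ] (splitAt c l)) ] (splitAt c r)

  module _ (A : Matrix c c) (B : Matrix c s) (C : Matrix s c) (D : Matrix s s) where

    top-block-· : ∀ {k} (M : Matrix (c ℕ.+ s) k) → top (block A B C D · M) ≋ A · top M +ᴹ B · bottom M
    top-block-· M i j = trans (·-split (block A B C D) M (i ↑ˡ s) j) (cong₂ _+_
      (sumFin-cong c (λ l → cong (_* top M l j) (entryᴬ l)))
      (sumFin-cong s (λ t → cong (_* bottom M t j) (entryᴮ t))))
      where
      entryᴬ : ∀ l → block A B C D (i ↑ˡ s) (l ↑ˡ s) ≡ A i l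
      entryᴬ l rewrite FinP.splitAt-↑ˡ c i s | FinP.splitAt-↑ˡ c l s = refl
      entryᴮ : ∀ t → block A B C D (i ↑ˡ s) (c ↑ʳ t) ≡ B i t
      entryᴮ t rewrite FinP.splitAt-↑ˡ c i s | FinP.splitAt-↑ʳ c s t = refl

    bottom-block-· : ∀ {k} (M : Matrix (c ℕ.+ s) k) → bottom (block A B C D · M) ≋ C · top M +ᴹ D · bottom M
    bottom-block-· M u j = trans (·-split (block A B C D) M (c ↑ʳ u) j) (cong₂ _+_
      (sumFin-cong c (λ l → cong (_* top M l j) (entryᶜ l)))
      (sumFin-cong s (λ t → cong (_* bottom M t j) (entryᴰ t))))
      where
      entryᶜ : ∀ l → block A B C D (c ↑ʳ u) (l ↑ˡ s) ≡ C u l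
      entryᶜ l rewrite FinP.splitAt-↑ʳ c s u | FinP.splitAt-↑ˡ c l s = refl
      entryᴰ : ∀ t → block A B C D (c ↑ʳ u) (c ↑ʳ t) ≡ D u t
      entryᴰ t rewrite FinP.splitAt-↑ʳ c s u | FinP.splitAt-↑ʳ c s t = refl

  shearUp : Matrix c s → Matrix (c ℕ.+ s) (c ℕ.+ s)
  shearUp N = block (identity c) N 0ᴹ (identity s)

  shearLo : Matrix s c → Matrix (c ℕ.+ s) (c ℕ.+ s)
  shearLo N = block (identity c) 0ᴹ N (identity s)

  module _ {k : ℕ} (M : Matrix (c ℕ.+ s) k) where

    top-shearUp-· : ∀ N → top (shearUp N · M) ≋ top M +ᴹ N · bottom M
    top-shearUp-· N = ≋-trans (top-block-· _ N 0ᴹ _ M) (+ᴹ-cong (·-identityˡ (top M)) ≋-refl)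

    bottom-shearUp-· : ∀ N → bottom (shearUp N · M) ≋ bottom M
    bottom-shearUp-· N = ≋-trans (bottom-block-· _ N 0ᴹ _ M)
      (≋-trans (+ᴹ-cong (·-zeroˡ (top M)) (·-identityˡ (bottom M))) (+-identityᴹˡ (bottom M)))

    top-shearLo-· : ∀ N → top (shearLo N · M) ≋ top M
    top-shearLo-· N = ≋-trans (top-block-· _ 0ᴹ N _ M)
      (≋-trans (+ᴹ-cong (·-identityˡ (top M)) (·-zeroˡ (bottom M))) (+-identityᴹʳ (top M)))

    bottom-shearLo-· : ∀ N → bottom (shearLo N · M) ≋ bottom M +ᴹ N · top M
    bottom-shearLo-· N = ≋-trans (bottom-block-· _ 0ᴹ N _ M)
      (≋-trans (+ᴹ-congˡ (N · top M) (·-identityˡ (bottom M))) (+-commᴹ (N · top M) (bottom M)))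

  shearUp-cancel : ∀ {N N'} → N' +ᴹ N ≋ 0ᴹ → shearUp N · shearUp N' ≋ identity (c ℕ.+ s)
  shearUp-cancel {N} {N'} N'+N≋0 = ≋-trans (·-congˡ (shearUp N) (≋-sym (·-identityʳ (shearUp N')))) (≋-blocks
    (begin
      top (shearUp N · (shearUp N' · I))                  ≈⟨ top-shearUp-· (shearUp N' · I) N ⟩
      top (shearUp N' · I) +ᴹ N · bottom (shearUp N' · I) ≈⟨ +ᴹ-cong (top-shearUp-· I N') (·-congˡ N (bottom-shearUp-· I N')) ⟩
      (top I +ᴹ N' · bottom I) +ᴹ N · bottom I            ≈⟨ +-assocᴹ (top I) (N' · bottom I) (N · bottom I) ⟩
      top I +ᴹ (N' · bottom I +ᴹ N · bottom I)            ≈⟨ +ᴹ-congˡ (top I) (·-distribʳ-+ᴹ N' N (bottom I)) ⟨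
      top I +ᴹ (N' +ᴹ N) · bottom I                       ≈⟨ +ᴹ-congˡ (top I) (≋-trans (·-congʳ (bottom I) N'+N≋0) (·-zeroˡ (bottom I))) ⟩
      top I +ᴹ 0ᴹ                                         ≈⟨ +-identityᴹʳ (top I) ⟩
      top I                                               ∎)
    (≋-trans (bottom-shearUp-· (shearUp N' · I) N) (bottom-shearUp-· I N')))
    where
    open ≋-Reasoning
    I = identity (c ℕ.+ s)

  shearLo-cancel : ∀ {N N'} → N' +ᴹ N ≋ 0ᴹ → shearLo N · shearLo N' ≋ identity (c ℕ.+ s)
  shearLo-cancel {N} {N'} N'+N≋0 = ≋-trans (·-congˡ (shearLo N) (≋-sym (·-identityʳ (shearLo N')))) (≋-blocks
    (≋-trans (top-shearLo-· (shearLo N' · I) N) (top-shearLo-· I N'))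
    (begin
      bottom (shearLo N · (shearLo N' · I))               ≈⟨ bottom-shearLo-· (shearLo N' · I) N ⟩
      bottom (shearLo N' · I) +ᴹ N · top (shearLo N' · I) ≈⟨ +ᴹ-cong (bottom-shearLo-· I N') (·-congˡ N (top-shearLo-· I N')) ⟩
      (bottom I +ᴹ N' · top I) +ᴹ N · top I               ≈⟨ +-assocᴹ (bottom I) (N' · top I) (N · top I) ⟩
      bottom I +ᴹ (N' · top I +ᴹ N · top I)               ≈⟨ +ᴹ-congˡ (bottom I) (·-distribʳ-+ᴹ N' N (top I)) ⟨
      bottom I +ᴹ (N' +ᴹ N) · top I                       ≈⟨ +ᴹ-congˡ (bottom I) (≋-trans (·-congʳ (top I) N'+N≋0) (·-zeroˡ (top I))) ⟩
      bottom I +ᴹ 0ᴹ                                      ≈⟨ +-identityᴹʳ (bottom I) ⟩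
      bottom I                                            ∎))
    where
    open ≋-Reasoning
    I = identity (c ℕ.+ s)

  shearUp-unimodular : ∀ N → Unimodular (shearUp N)
  shearUp-unimodular N = shearUp (-ᴹ N) ,
    shearUp-cancel (λ i j → ℤP.+-inverseˡ (N i j)) , shearUp-cancel (λ i j → ℤP.+-inverseʳ (N i j))

  shearLo-unimodular : ∀ N → Unimodular (shearLo N)
  shearLo-unimodular N = shearLo (-ᴹ N) ,
    shearLo-cancel (λ i j → ℤP.+-inverseˡ (N i j)) , shearLo-cancel (λ i j → ℤP.+-inverseʳ (N i j))

  top-diagR : ∀ (d : Fin c → ℕ) → top (diagR (c ℕ.+ s) d) ≋ diagR c d
  top-diagR d i j rewrite FinP.toℕ-↑ˡ i s = refl

  bottom-diagR : ∀ (d : Fin c → ℕ) → bottom (diagR (c ℕ.+ s) d) ≋ 0ᴹ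
  bottom-diagR d t j = cong (λ b → if b then + d j else + 0) (dec-false (toℕ (c ↑ʳ t) ℕ.≟ toℕ j) index-too-large)
    where
    index-too-large : toℕ (c ↑ʳ t) ≢ toℕ j
    index-too-large eq = ℕP.<-irrefl (sym eq) (begin-strict
      toℕ j        <⟨ FinP.toℕ<n j ⟩
      c            ≤⟨ ℕP.m≤m+n c (toℕ t) ⟩
      c ℕ.+ toℕ t  ≡⟨ FinP.toℕ-↑ʳ c t ⟨
      toℕ (c ↑ʳ t) ∎)
      where open ℕP.≤-Reasoning

-- Row lattices

-- A · Q and diag d have the same row lattice: each one's rows are integer combinations (X, resp. Y) of the other's.
record DiagonalRowLattice {r c} (A : Matrix r c) (d : Fin c → ℕ) : Set where
  field
    Q            : Matrix c c
    Q-unimodular : Unimodular Q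
    X            : Matrix r c
    AQ≋XD        : A · Q ≋ X · diagR c d
    Y            : Matrix c r
    D≋YAQ        : diagR c d ≋ Y · (A · Q)

EquivZ⇒DiagonalRowLattice : ∀ {c s} {A : Matrix (c ℕ.+ s) c} {d : Fin c → ℕ} →
  EquivZ A (diagR (c ℕ.+ s) d) → DiagonalRowLattice A d
EquivZ⇒DiagonalRowLattice {c} {s} {A} {d} (P , Q , (P⁻¹ , _ , P⁻¹P≋I) , Q-unimodular , PAQ≋D) = record
  { Q            = Q
  ; Q-unimodular = Q-unimodular
  ; X            = leftCols P⁻¹
  ; AQ≋XD        = begin
      A · Q                                                 ≈⟨ ·-congʳ Q (·-identityˡ A) ⟨
      (identity _ · A) · Q                                  ≈⟨ ·-congʳ Q (·-congʳ A P⁻¹P≋I) ⟨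
      ((P⁻¹ · P) · A) · Q                                   ≈⟨ ·-congʳ Q (·-assoc P⁻¹ P A) ⟩
      (P⁻¹ · (P · A)) · Q                                   ≈⟨ ·-assoc P⁻¹ (P · A) Q ⟩
      P⁻¹ · ((P · A) · Q)                                   ≈⟨ ·-congˡ P⁻¹ PAQ≋D ⟩
      P⁻¹ · diagR _ d                                       ≈⟨ ·-split P⁻¹ (diagR _ d) ⟩
      leftCols P⁻¹ · top (diagR _ d) +ᴹ rightCols P⁻¹ · bottom (diagR _ d)
                                                            ≈⟨ +ᴹ-cong (·-congˡ (leftCols P⁻¹) (top-diagR d)) (·-congˡ (rightCols P⁻¹) (bottom-diagR d)) ⟩
      leftCols P⁻¹ · diagR c d +ᴹ rightCols P⁻¹ · 0ᴹ        ≈⟨ ≋-trans (+ᴹ-congˡ (leftCols P⁻¹ · diagR c d) (·-zeroʳ (rightCols P⁻¹))) (+-identityᴹʳ _) ⟩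
      leftCols P⁻¹ · diagR c d                              ∎
  ; Y            = top P
  ; D≋YAQ        = begin
      diagR c d                                             ≈⟨ top-diagR d ⟨
      top (diagR _ d)                                       ≈⟨ (λ i j → PAQ≋D (i ↑ˡ s) j) ⟨
      top ((P · A) · Q)                                     ≈⟨ (λ i j → ·-assoc P A Q (i ↑ˡ s) j) ⟩
      top P · (A · Q)                                       ∎
  }
  where
  open Blocks c s
  open ≋-Reasoning

DiagonalRowLattice-⊗ : ∀ {r₁ c₁ r₂ c₂} {A : Matrix r₁ c₁} {B : Matrix r₂ c₂} {a : Fin c₁ → ℕ} {b : Fin c₂ → ℕ} →
  DiagonalRowLattice A a → DiagonalRowLattice B b → DiagonalRowLattice (A ⊗ B) (a ⊗ᵥ b)
DiagonalRowLattice-⊗ {c₁ = c₁} {c₂ = c₂} {A} {B} {a} {b} L₁ L₂ = record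
  { Q            = Q₁ ⊗ Q₂
  ; Q-unimodular = Unimodular-⊗ Q₁-unimodular Q₂-unimodular
  ; X            = X₁ ⊗ X₂
  ; AQ≋XD        = begin
      (A ⊗ B) · (Q₁ ⊗ Q₂)                  ≈⟨ ⊗-mixed-product A B Q₁ Q₂ ⟩
      (A · Q₁) ⊗ (B · Q₂)                  ≈⟨ ⊗-cong AQ₁≋X₁D₁ BQ₂≋X₂D₂ ⟩
      (X₁ · diagR c₁ a) ⊗ (X₂ · diagR c₂ b) ≈⟨ ⊗-mixed-product X₁ X₂ (diagR c₁ a) (diagR c₂ b) ⟨
      (X₁ ⊗ X₂) · (diagR c₁ a ⊗ diagR c₂ b) ≈⟨ ·-congˡ (X₁ ⊗ X₂) (diagR-⊗ c₁ c₂ a b) ⟩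
      (X₁ ⊗ X₂) · diagR _ (a ⊗ᵥ b)          ∎
  ; Y            = Y₁ ⊗ Y₂
  ; D≋YAQ        = begin
      diagR _ (a ⊗ᵥ b)                      ≈⟨ diagR-⊗ c₁ c₂ a b ⟨
      diagR c₁ a ⊗ diagR c₂ b               ≈⟨ ⊗-cong D₁≋Y₁AQ₁ D₂≋Y₂BQ₂ ⟩
      (Y₁ · (A · Q₁)) ⊗ (Y₂ · (B · Q₂))     ≈⟨ ⊗-mixed-product Y₁ Y₂ (A · Q₁) (B · Q₂) ⟨
      (Y₁ ⊗ Y₂) · ((A · Q₁) ⊗ (B · Q₂))     ≈⟨ ·-congˡ (Y₁ ⊗ Y₂) (⊗-mixed-product A B Q₁ Q₂) ⟨
      (Y₁ ⊗ Y₂) · ((A ⊗ B) · (Q₁ ⊗ Q₂))     ∎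
  }
  where
  open ≋-Reasoning
  open DiagonalRowLattice L₁ renaming (Q to Q₁; Q-unimodular to Q₁-unimodular; X to X₁; AQ≋XD to AQ₁≋X₁D₁; Y to Y₁; D≋YAQ to D₁≋Y₁AQ₁)
  open DiagonalRowLattice L₂ renaming (Q to Q₂; Q-unimodular to Q₂-unimodular; X to X₂; AQ≋XD to BQ₂≋X₂D₂; Y to Y₂; D≋YAQ to D₂≋Y₂BQ₂)

DiagonalRowLattice-rows : ∀ {r r' c} {A : Matrix r c} {K : Matrix r' c} {d : Fin c → ℕ} →
  SameRowSet A K → DiagonalRowLattice K d → DiagonalRowLattice A d
DiagonalRowLattice-rows {r} {r'} {c} {A} {K} {d} (toK , fromK) L = record
  { Q            = Q
  ; Q-unimodular = Q-unimodular
  ; X            = λ i → X (proj₁ (toK i))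
  ; AQ≋XD        = λ i j → trans (sumFin-cong c (λ l → cong (_* Q l j) (proj₂ (toK i) l))) (AQ≋XD (proj₁ (toK i)) j)
  ; Y            = Y · select
  ; D≋YAQ        = begin
      diagR c d               ≈⟨ D≋YAQ ⟩
      Y · (K · Q)             ≈⟨ ·-congˡ Y KQ≋select·AQ ⟩
      Y · (select · (A · Q))  ≈⟨ ·-assoc Y select (A · Q) ⟨
      (Y · select) · (A · Q)  ∎
  }
  where
  open ≋-Reasoning
  open DiagonalRowLattice L
  select : Matrix r' r
  select i' = identity r (proj₁ (fromK i'))
  KQ≋select·AQ : K · Q ≋ select · (A · Q)
  KQ≋select·AQ i' j = trans (sumFin-cong c (λ l → cong (_* Q l j) (sym (proj₂ (fromK i') l))))
                            (sym (·-identityˡ (A · Q) (proj₁ (fromK i')) j))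

-- Two row shears bring A · Q to diag(d) stacked on zeros: shearUp replaces the top block by D, a combination
-- of the bottom rows because the top rows are such combinations; shearLo then subtracts bottom X · D = bottom.
DiagonalRowLattice⇒EquivZ : ∀ {c s} {A : Matrix (c ℕ.+ s) c} {d : Fin c → ℕ} (T : Matrix c s) →
  Blocks.top c s A ≋ T · Blocks.bottom c s A → DiagonalRowLattice A d → EquivZ A (diagR (c ℕ.+ s) d)
DiagonalRowLattice⇒EquivZ {c} {s} {A} {d} T topA≋T·bottomA L =
  shearLo N₂ · shearUp N₁ , Q ,
  Unimodular-· (shearLo-unimodular N₂) (shearUp-unimodular N₁) , Q-unimodular , (begin
    ((shearLo N₂ · shearUp N₁) · A) · Q     ≈⟨ ·-assoc (shearLo N₂ · shearUp N₁) A Q ⟩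
    (shearLo N₂ · shearUp N₁) · B           ≈⟨ ·-assoc (shearLo N₂) (shearUp N₁) B ⟩
    shearLo N₂ · (shearUp N₁ · B)           ≈⟨ ≋-blocks top-cleared bottom-cleared ⟩
    diagR (c ℕ.+ s) d                       ∎)
  where
  open ≋-Reasoning
  open Blocks c s
  open DiagonalRowLattice L
  B = A · Q
  D = diagR c d
  topB≋T·bottomB : top B ≋ T · bottom B
  topB≋T·bottomB = ≋-trans (·-congʳ Q topA≋T·bottomA) (·-assoc T (bottom A) Q)
  C = leftCols Y · T +ᴹ rightCols Y
  D≋C·bottomB : D ≋ C · bottom B
  D≋C·bottomB = begin
    D                                                          ≈⟨ D≋YAQ ⟩
    Y · B                                                      ≈⟨ ·-split Y B ⟩
    leftCols Y · top B +ᴹ rightCols Y · bottom B               ≈⟨ +ᴹ-cong (·-congˡ (leftCols Y) topB≋T·bottomB) ≋-refl ⟩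
    leftCols Y · (T · bottom B) +ᴹ rightCols Y · bottom B      ≈⟨ +ᴹ-cong (·-assoc (leftCols Y) T (bottom B)) ≋-refl ⟨
    (leftCols Y · T) · bottom B +ᴹ rightCols Y · bottom B      ≈⟨ ·-distribʳ-+ᴹ (leftCols Y · T) (rightCols Y) (bottom B) ⟨
    C · bottom B                                               ∎
  N₁ = C +ᴹ -ᴹ T
  B₁ = shearUp N₁ · B
  topB₁≋D : top B₁ ≋ D
  topB₁≋D = begin
    top B₁                                               ≈⟨ top-shearUp-· B N₁ ⟩
    top B +ᴹ (C +ᴹ -ᴹ T) · bottom B                      ≈⟨ +ᴹ-cong topB≋T·bottomB (·-distribʳ-+ᴹ C (-ᴹ T) (bottom B)) ⟩
    T · bottom B +ᴹ (C · bottom B +ᴹ (-ᴹ T) · bottom B)  ≈⟨ +ᴹ-congˡ (T · bottom B) (+ᴹ-cong (≋-sym D≋C·bottomB) (·-negˡ T (bottom B))) ⟩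
    T · bottom B +ᴹ (D +ᴹ -ᴹ (T · bottom B))             ≈⟨ (λ i j → cancel ((T · bottom B) i j) (D i j)) ⟩
    D                                                    ∎
    where
    cancel : ∀ x y → x + (y + - x) ≡ y
    cancel = solve-∀
  N₂ = -ᴹ bottom X
  top-cleared : top (shearLo N₂ · B₁) ≋ top (diagR (c ℕ.+ s) d)
  top-cleared = ≋-trans (top-shearLo-· B₁ N₂) (≋-trans topB₁≋D (≋-sym (top-diagR d)))
  bottom-cleared : bottom (shearLo N₂ · B₁) ≋ bottom (diagR (c ℕ.+ s) d)
  bottom-cleared = begin
    bottom (shearLo N₂ · B₁)               ≈⟨ bottom-shearLo-· B₁ N₂ ⟩
    bottom B₁ +ᴹ (-ᴹ bottom X) · top B₁    ≈⟨ +ᴹ-cong (bottom-shearUp-· B N₁) (·-negˡ (bottom X) (top B₁)) ⟩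
    bottom B +ᴹ -ᴹ (bottom X · top B₁)     ≈⟨ +ᴹ-cong (λ t → AQ≋XD (c ↑ʳ t)) (λ i j → cong -_ (·-congˡ (bottom X) topB₁≋D i j)) ⟩
    bottom X · D +ᴹ -ᴹ (bottom X · D)      ≈⟨ (λ i j → ℤP.+-inverseʳ ((bottom X · D) i j)) ⟩
    0ᴹ                                     ≈⟨ bottom-diagR d ⟨
    bottom (diagR (c ℕ.+ s) d)             ∎

-- Matrices of strong products

inN-refl : ∀ {m} (G : Graph m) u → inN G u u ≡ true
inN-refl G u rewrite ==-refl u = refl

inN-⊠ : ∀ {m n} (G : Graph m) (H : Graph n) (p q : Fin (m ℕ.* n)) →
  inN (G ⊠ H) p q ≡ inN G (quotient {m} n p) (quotient {m} n q) ∧ inN H (remainder {m} n p) (remainder {m} n q)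
inN-⊠ {m} {n} G H p q with p ≟ q
... | yes refl rewrite inN-refl G (quotient {m} n p) | inN-refl H (remainder {m} n p) = refl
... | no _     = refl

inN-⊠-combine : ∀ {m n} (G : Graph m) (H : Graph n) u v u' v' →
  inN (G ⊠ H) (combine u v) (combine u' v') ≡ inN G u u' ∧ inN H v v'
inN-⊠-combine {m} {n} G H u v u' v'
  rewrite inN-⊠ G H (combine u v) (combine u' v')
        | quotient-combine {m} {n} u v | remainder-combine {m} {n} u v
        | quotient-combine {m} {n} u' v' | remainder-combine {m} {n} u' v' = refl

activation-⊠ : ∀ {m n} (G : Graph m) (H : Graph n) → activation (G ⊠ H) ≋ activation G ⊗ activation H
activation-⊠ {m} {n} G H p q = trans (cong ind (inN-⊠ G H p q))
  (ind-∧ (inN G (quotient {m} n p) (quotient {m} n q)) (inN H (remainder {m} n p) (remainder {m} n q)))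

data RARow (m : ℕ) : Fin (m ℕ.+ m ℕ.* m) → Set where
  single : (v : Fin m) → RARow m (v ↑ˡ m ℕ.* m)
  pair   : (u v : Fin m) → RARow m (m ↑ʳ combine u v)

raRow : ∀ m r → RARow m r
raRow m r with splitAt m r in eq
... | inj₁ v = subst (RARow m) (FinP.splitAt⁻¹-↑ˡ eq) (single v)
... | inj₂ p with combineView m m p
...   | combined u v = subst (RARow m) (FinP.splitAt⁻¹-↑ʳ eq) (pair u v)

RA-single : ∀ {m} (G : Graph m) v w → RA G (v ↑ˡ m ℕ.* m) w ≡ ind (inN G v w)
RA-single {m} G v w rewrite FinP.splitAt-↑ˡ m v (m ℕ.* m) = refl

RA-pair : ∀ {m} (G : Graph m) u v w → RA G (m ↑ʳ combine u v) w ≡ ind (inN G u w ∧ inN G v w)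
RA-pair {m} G u v w rewrite FinP.splitAt-↑ʳ m (m ℕ.* m) (combine u v) =
  cong (λ (x , y) → ind (inN G x w ∧ inN G y w)) (FinP.remQuot-combine {m} {m} u v)

∧-absorbʳ-interchange : ∀ a b a' → (a ∧ b) ∧ (a' ∧ b) ≡ (a ∧ a') ∧ b
∧-absorbʳ-interchange a b a' = trans (∧-interchange a b a' b) (cong ((a ∧ a') ∧_) (BoolP.∧-idem b))

∧-absorbˡ-interchange : ∀ a b b' → (a ∧ b) ∧ (a ∧ b') ≡ a ∧ (b ∧ b')
∧-absorbˡ-interchange a b b' = trans (∧-interchange a b a b') (cong (_∧ (b ∧ b')) (BoolP.∧-idem a))

module _ {m n : ℕ} (G : Graph m) (H : Graph n) where

  private
    M = m ℕ.* n
    Kron = RA G ⊗ RA H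

  RA-⊠-single : ∀ u v w w' → RA (G ⊠ H) (combine u v ↑ˡ M ℕ.* M) (combine w w') ≡ ind (inN G u w ∧ inN H v w')
  RA-⊠-single u v w w' = trans (RA-single (G ⊠ H) (combine u v) (combine w w')) (cong ind (inN-⊠-combine G H u v w w'))

  RA-⊠-pair : ∀ u v u' v' w w' → RA (G ⊠ H) (M ↑ʳ combine (combine u v) (combine u' v')) (combine w w')
              ≡ ind ((inN G u w ∧ inN H v w') ∧ (inN G u' w ∧ inN H v' w'))
  RA-⊠-pair u v u' v' w w' = trans (RA-pair (G ⊠ H) (combine u v) (combine u' v') (combine w w'))
    (cong ind (cong₂ _∧_ (inN-⊠-combine G H u v w w') (inN-⊠-combine G H u' v' w w')))

  ⊠-row≡⊗-row : ∀ {r x y} (α : Fin m → Bool) (β : Fin n → Bool) →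
    (∀ w → RA G x w ≡ ind (α w)) → (∀ w' → RA H y w' ≡ ind (β w')) →
    (∀ w w' → RA (G ⊠ H) r (combine w w') ≡ ind (α w ∧ β w')) →
    ∀ j → RA (G ⊠ H) r j ≡ Kron (combine x y) j
  ⊠-row≡⊗-row {r} {x} {y} α β rowˣ rowʸ rowʳ j with combineView m n j
  ... | combined w w' = begin
    RA (G ⊠ H) r (combine w w')     ≡⟨ rowʳ w w' ⟩
    ind (α w ∧ β w')                ≡⟨ ind-∧ (α w) (β w') ⟩
    ind (α w) * ind (β w')          ≡⟨ cong₂ _*_ (rowˣ w) (rowʸ w') ⟨
    RA G x w * RA H y w'            ≡⟨ ⊗-combine (RA G) (RA H) x y w w' ⟨
    Kron (combine x y) (combine w w') ∎
    where open ≡-Reasoning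

  RA-⊠-rows : SameRowSet (RA (G ⊠ H)) Kron
  RA-⊠-rows = toKron , fromKron
    where
    toKron : ∀ r → Σ _ λ k → ∀ j → RA (G ⊠ H) r j ≡ Kron k j
    toKron r with raRow M r
    ... | single p with combineView m n p
    ...   | combined u v = _ , ⊠-row≡⊗-row (inN G u) (inN H v) (RA-single G u) (RA-single H v) (RA-⊠-single u v)
    toKron r | pair p p' with combineView m n p | combineView m n p'
    ...   | combined u v | combined u' v' =
      _ , ⊠-row≡⊗-row (λ w → inN G u w ∧ inN G u' w) (λ w' → inN H v w' ∧ inN H v' w') (RA-pair G u u') (RA-pair H v v')
            (λ w w' → trans (RA-⊠-pair u v u' v' w w') (cong ind (∧-interchange (inN G u w) (inN H v w') (inN G u' w) (inN H v' w'))))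
    fromKron : ∀ k → Σ _ λ r → ∀ j → RA (G ⊠ H) r j ≡ Kron k j
    fromKron k with combineView (m ℕ.+ m ℕ.* m) (n ℕ.+ n ℕ.* n) k
    ... | combined x y with raRow m x | raRow n y
    ...   | single u    | single v    =
      _ , ⊠-row≡⊗-row (inN G u) (inN H v) (RA-single G u) (RA-single H v) (RA-⊠-single u v)
    ...   | pair u u'   | single v    =
      _ , ⊠-row≡⊗-row (λ w → inN G u w ∧ inN G u' w) (inN H v) (RA-pair G u u') (RA-single H v)
            (λ w w' → trans (RA-⊠-pair u v u' v w w') (cong ind (∧-absorbʳ-interchange (inN G u w) (inN H v w') (inN G u' w))))
    ...   | single u    | pair v v'   =
      _ , ⊠-row≡⊗-row (inN G u) (λ w' → inN H v w' ∧ inN H v' w') (RA-single G u) (RA-pair H v v')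
            (λ w w' → trans (RA-⊠-pair u v u v' w w') (cong ind (∧-absorbˡ-interchange (inN G u w) (inN H v w') (inN H v' w'))))
    ...   | pair u u'   | pair v v'   =
      _ , ⊠-row≡⊗-row (λ w → inN G u w ∧ inN G u' w) (λ w' → inN H v w' ∧ inN H v' w') (RA-pair G u u') (RA-pair H v v')
            (λ w w' → trans (RA-⊠-pair u v u' v' w w') (cong ind (∧-interchange (inN G u w) (inN H v w') (inN G u' w) (inN H v' w'))))

selectDiagonalPairs : ∀ m → Matrix m (m ℕ.* m)
selectDiagonalPairs m v = identity (m ℕ.* m) (combine v v)

RA-top≋diagonal-pairs : ∀ {m} (G : Graph m) →
  Blocks.top m (m ℕ.* m) (RA G) ≋ selectDiagonalPairs m · Blocks.bottom m (m ℕ.* m) (RA G)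
RA-top≋diagonal-pairs {m} G v w = begin
  RA G (v ↑ˡ m ℕ.* m) w                  ≡⟨ RA-single G v w ⟩
  ind (inN G v w)                        ≡⟨ cong ind (BoolP.∧-idem (inN G v w)) ⟨
  ind (inN G v w ∧ inN G v w)            ≡⟨ RA-pair G v v w ⟨
  RA G (m ↑ʳ combine v v) w              ≡⟨ ·-identityˡ (Blocks.bottom m (m ℕ.* m) (RA G)) (combine v v) w ⟨
  (identity _ · Blocks.bottom m (m ℕ.* m) (RA G)) (combine v v) w ∎
  where open ≡-Reasoning

EquivZ-diagR-⊗ : ∀ {m n} {A : Matrix m m} {B : Matrix n n} {a : Fin m → ℕ} {b : Fin n → ℕ} →
  EquivZ A (diagR m a) → EquivZ B (diagR n b) → EquivZ (A ⊗ B) (diagR (m ℕ.* n) (a ⊗ᵥ b))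
EquivZ-diagR-⊗ {m} {n} {a = a} {b} A~a B~b = EquivZ-trans (EquivZ-⊗ A~a B~b) (≋⇒EquivZ (diagR-⊗ m n a b))

mainTheorem14 : (m n : ℕ) (Γ₁ : Graph m) (Γ₂ : Graph n) →
    (∀ p q → activation (Γ₁ ⊠ Γ₂) p q ≡ (activation Γ₁ ⊗ activation Γ₂) p q)
    × (∀ (a : Fin m → ℕ) (b : Fin n → ℕ) →
         ElementaryDivisors (activation Γ₁) a → ElementaryDivisors (activation Γ₂) b →
         EquivZ (activation (Γ₁ ⊠ Γ₂)) (diagR (m ℕ.* n) (λ p → a (quotient n p) ℕ.* b (remainder {m} n p))))
    × SameRowSet (RA (Γ₁ ⊠ Γ₂)) (RA Γ₁ ⊗ RA Γ₂)
    × (∀ (c : Fin m → ℕ) (d : Fin n → ℕ) →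
         ElementaryDivisors (RA Γ₁) c → ElementaryDivisors (RA Γ₂) d →
         EquivZ (RA (Γ₁ ⊠ Γ₂)) (diagR _ (λ p → c (quotient n p) ℕ.* d (remainder {m} n p))))
mainTheorem14 m n Γ₁ Γ₂ =
  activation-⊠ Γ₁ Γ₂ ,
  (λ a b (_ , A₁~a) (_ , A₂~b) → EquivZ-trans (≋⇒EquivZ (activation-⊠ Γ₁ Γ₂)) (EquivZ-diagR-⊗ A₁~a A₂~b)) ,
  RA-⊠-rows Γ₁ Γ₂ ,
  λ c d (_ , C₁~c) (_ , C₂~d) →
    DiagonalRowLattice⇒EquivZ (selectDiagonalPairs (m ℕ.* n)) (RA-top≋diagonal-pairs (Γ₁ ⊠ Γ₂))
      (DiagonalRowLattice-rows (RA-⊠-rows Γ₁ Γ₂)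
        (DiagonalRowLattice-⊗ (EquivZ⇒DiagonalRowLattice C₁~c) (EquivZ⇒DiagonalRowLattice C₂~d)))
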